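{- Let $N=\{1,\dots,n\}$ be a set of agents and $M$ a finite set of items, and let each agent $i$ have a monotone valuation $v_i\colon 2^M\to\mathbb{R}_{\ge0}$. Let $(\mathcal{X},\mu)$ be an allocation, and let $(G,w)$ be its assign-envy graph $G(\mathcal{X},\mu)$. Let $(G_\mu,w_\mu)$ be the auxiliary weighted graph for the perfect matching $\mu$. If $G_\mu$ contains a directed cycle $C$, then $w_\mu(C)<0$.
   Context: An allocation is a pair $(\mathcal{X},\mu)$ where $\mathcal{X}=(X_i)_{i\in N}$ is an $N$-indexed family of pairwise disjoint subsets of $M$ (bundles; distinct indices give distinct bundles even if the sets coincide) and $\mu\colon N\to\mathcal{X}$ is a bijection assigning bundle $\mu(i)$ to agent $i$. The assign-envy graph $G(\mathcal{X},\mu)$ is the bipartite graph with vertex classes $N$ and $\mathcal{X}$ and edge set $E(\mathcal{X},\mu)=\{(i,\mu(i))\mid i\in N\}\cup\{(i,X_j)\mid i\in N,\ X_j\in\mathcal{X},\ v_i(\mu(i))<v_i(X_j)\}$, with weights $w((i,X_j))=-v_i(X_j)$; the bijection $\mu$ is regarded as a perfect matching in it. The auxiliary graph $G_\mu$ is the directed graph obtained by directing the non-matching edges from $N$ to $\mathcal{X}$ with weight $w(e)$ and the matching edges from $\mathcal{X}$ to $N$ with weight $-w(e)$; $w_\mu(C)$ is the sum of these weights over the arcs of $C$.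
   Formalization: The valuations $v_i$ take values in the nonnegative rationals instead of $\mathbb{R}_{\ge0}$. -}

module Defs where

open import Data.Nat using (ℕ; suc)
open import Data.Fin using (Fin; zero; suc; inject₁; fromℕ)
open import Data.Fin.Subset using (Subset; _∈_; _⊆_)
open import Data.Rational using (ℚ; 0ℚ; _+_; -_; _<_; _≤_)
open import Data.Empty using (⊥)
open import Data.Product using (_×_)
open import Relation.Binary.PropositionalEquality using (_≡_; _≢_)
open import Function.Definitions using (Bijective; Injective)

-- A valuation profile: v i S is agent i's value for bundle S.
-- (Real values are replaced by rationals.)
Valuations : ℕ → ℕ → Set
Valuations n m = Fin n → Subset m → ℚ

IsMonotoneNonneg : ∀ {n m} → Valuations n m → Set
IsMonotoneNonneg {n} {m} v =
  (∀ (i : Fin n) (S : Subset m) → 0ℚ ≤ v i S) ×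
  (∀ (i : Fin n) (S T : Subset m) → S ⊆ T → v i S ≤ v i T)

-- An allocation (X, μ): an N-indexed family of pairwise disjoint bundles,
-- and a bijection μ : N → (indices of) bundles; agent i receives X (μ i).
record Allocation (n m : ℕ) : Set where
  field
    X         : Fin n → Subset m
    disjoint  : ∀ (j k : Fin n) → j ≢ k → ∀ (x : Fin m) → x ∈ X j → x ∈ X k → ⊥
    μ         : Fin n → Fin n
    μ-bij     : Bijective _≡_ _≡_ μ

data Vertex (n : ℕ) : Set where
  agent  : Fin n → Vertex n
  bundle : Fin n → Vertex n

module AuxGraph {n m : ℕ} (v : Valuations n m) (A : Allocation n m) where
  open Allocation A

  data Edge (i j : Fin n) : Set where
    matchEdge : μ i ≡ j → Edge i j
    envyEdge  : v i (X (μ i)) < v i (X j) → Edge i j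

  w : Fin n → Fin n → ℚ
  w i j = - v i (X j)

  data Arc : Vertex n → Vertex n → Set where
    fwd : ∀ {i j} → Edge i j → μ i ≢ j → Arc (agent i) (bundle j)
    bwd : ∀ {i j} → μ i ≡ j → Arc (bundle j) (agent i)

  wμ : ∀ {a b} → Arc a b → ℚ
  wμ (fwd {i} {j} _ _) = w i j
  wμ (bwd {i} {j} _)   = - w i j

  record Cycle : Set where
    field
      len     : ℕ
      vert    : Fin (suc len) → Vertex n
      distinct : Injective _≡_ _≡_ vert
      step    : (t : Fin len) → Arc (vert (inject₁ t)) (vert (suc t))
      close   : Arc (vert (fromℕ len)) (vert zero)

  sumFin : (k : ℕ) → (Fin k → ℚ) → ℚ
  sumFin ℕ.zero    f = 0ℚ
  sumFin (suc k) f = f zero + sumFin k (λ t → f (suc t))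

  cycleWeight : Cycle → ℚ
  cycleWeight C = sumFin len (λ t → wμ (step t)) + wμ close
    where open Cycle C

-- Give agent i the potential v_i(μ(i)) and every bundle the potential 0. Along each arc of G_μ
-- the weight is then at most the increase of the potential: with equality on a matching arc
-- X_μ(i) → i, and strictly on an envy arc i → X_j because v_i(μ(i)) < v_i(X_j). Around a cycle
-- the potentials telescope, so w_μ(C) ≤ 0, and the inequality is strict because every arc, in
-- particular the closing one, has an agent at one of its ends.
module Submission where

open import Defs
open import Data.Nat using (ℕ; zero; suc)
open import Data.Fin using (Fin; zero; suc; inject₁; fromℕ)
open import Data.Rational using (ℚ; 0ℚ; _+_; -_; _<_; _≤_; +-0-rawMonoid)
open import Data.Rational.Properties
open import Data.Empty using (⊥-elim)
open import Data.Sum using (_⊎_; inj₁; inj₂)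
open import Function using (_∘_)
open import Relation.Binary.PropositionalEquality using (_≡_; refl; sym; trans; cong; subst; subst₂)
open import Algebra.Bundles using (CommutativeMonoid)
open import Algebra.Definitions.RawMonoid +-0-rawMonoid using (sum)
open import Algebra.Properties.CommutativeSemigroup
  (CommutativeMonoid.commutativeSemigroup +-0-commutativeMonoid) using (xy∙z≈y∙xz)
open import Algebra.Properties.Group +-0-group using (//-rightDividesʳ; ⁻¹-involutive)

p+q<q⇒p<0 : ∀ p q → p + q < q → p < 0ℚ
p+q<q⇒p<0 p q p+q<q = subst₂ _<_ (//-rightDividesʳ q p) (+-inverseʳ q) (+-monoˡ-< (- q) p+q<q)

q+[p+r]<r⇒p+q<0 : ∀ p q r → q + (p + r) < r → p + q < 0ℚ
q+[p+r]<r⇒p+q<0 p q r h = p+q<q⇒p<0 (p + q) r (subst (_< r) (sym (xy∙z≈y∙xz p q r)) h)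

module Potential {V : Set} (Arc : V → V → Set) (wt : ∀ {a b} → Arc a b → ℚ) (φ : V → ℚ)
  (Strict : V → Set)
  (wt+φ≤φ : ∀ {a b} (e : Arc a b) → wt e + φ a ≤ φ b)
  (wt+φ<φ : ∀ {a b} → Strict a → (e : Arc a b) → wt e + φ a < φ b)
  where
  open ≤-Reasoning

  Walk : (k : ℕ) → (Fin (suc k) → V) → Set
  Walk k vert = (t : Fin k) → Arc (vert (inject₁ t)) (vert (suc t))

  walk-≤ : ∀ k vert (steps : Walk k vert) → sum (wt ∘ steps) + φ (vert zero) ≤ φ (vert (fromℕ k))
  walk-≤ zero    vert steps = ≤-reflexive (+-identityˡ _)
  walk-≤ (suc k) vert steps = begin
    wt first + sum (wt ∘ rest) + φ (vert zero)    ≡⟨ xy∙z≈y∙xz (wt first) _ _ ⟩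
    sum (wt ∘ rest) + (wt first + φ (vert zero))  ≤⟨ +-monoʳ-≤ (sum (wt ∘ rest)) (wt+φ≤φ first) ⟩
    sum (wt ∘ rest) + φ (vert (suc zero))         ≤⟨ walk-≤ k (vert ∘ suc) rest ⟩
    φ (vert (fromℕ (suc k)))                      ∎
    where
    first = steps zero
    rest = steps ∘ suc

  walk-< : ∀ k vert (steps : Walk (suc k) vert) → Strict (vert zero) →
           sum (wt ∘ steps) + φ (vert zero) < φ (vert (fromℕ (suc k)))
  walk-< k vert steps strict′ = begin-strict
    wt first + sum (wt ∘ rest) + φ (vert zero)    ≡⟨ xy∙z≈y∙xz (wt first) _ _ ⟩
    sum (wt ∘ rest) + (wt first + φ (vert zero))  <⟨ +-monoʳ-< (sum (wt ∘ rest)) (wt+φ<φ strict′ first) ⟩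
    sum (wt ∘ rest) + φ (vert (suc zero))         ≤⟨ walk-≤ k (vert ∘ suc) rest ⟩
    φ (vert (fromℕ (suc k)))                      ∎
    where
    first = steps zero
    rest = steps ∘ suc

  closedWalk<0 : ∀ k vert (steps : Walk k vert) (close : Arc (vert (fromℕ k)) (vert zero)) →
                 Strict (vert (fromℕ k)) ⊎ Strict (vert zero) →
                 sum (wt ∘ steps) + wt close < 0ℚ
  closedWalk<0 k vert steps close (inj₁ strict′) =
    q+[p+r]<r⇒p+q<0 (sum (wt ∘ steps)) (wt close) (φ (vert zero))
      (≤-<-trans (+-monoʳ-≤ (wt close) (walk-≤ k vert steps)) (wt+φ<φ strict′ close))
  closedWalk<0 zero    vert steps close (inj₂ strict′) = closedWalk<0 zero vert steps close (inj₁ strict′)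
  closedWalk<0 (suc k) vert steps close (inj₂ strict′) =
    q+[p+r]<r⇒p+q<0 (sum (wt ∘ steps)) (wt close) (φ (vert zero))
      (<-≤-trans (+-monoʳ-< (wt close) (walk-< k vert steps strict′)) (wt+φ≤φ close))

data IsAgent {n : ℕ} : Vertex n → Set where
  agent : ∀ i → IsAgent (agent i)

module _ {n m : ℕ} (v : Valuations n m) (A : Allocation n m) where
  open Allocation A
  open AuxGraph v A

  ownValue : Vertex n → ℚ
  ownValue (agent i)  = v i (X (μ i))
  ownValue (bundle _) = 0ℚ

  arc-touches-agent : ∀ {a b} → Arc a b → IsAgent a ⊎ IsAgent b
  arc-touches-agent (fwd _ _) = inj₁ (agent _)
  arc-touches-agent (bwd _)   = inj₂ (agent _)

  wμ+ownValue<ownValue : ∀ {a b} → IsAgent a → (e : Arc a b) → wμ e + ownValue a < ownValue b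
  wμ+ownValue<ownValue (agent i) (fwd (matchEdge μi≡j) μi≢j) = ⊥-elim (μi≢j μi≡j)
  wμ+ownValue<ownValue (agent i) (fwd {j = j} (envyEdge envy) _) = begin-strict
    - v i (X j) + v i (X (μ i))  <⟨ +-monoʳ-< (- v i (X j)) envy ⟩
    - v i (X j) + v i (X j)      ≡⟨ +-inverseˡ (v i (X j)) ⟩
    0ℚ                           ∎
    where open ≤-Reasoning

  wμ+ownValue≤ownValue : ∀ {a b} (e : Arc a b) → wμ e + ownValue a ≤ ownValue b
  wμ+ownValue≤ownValue (fwd e μi≢j) = <⇒≤ (wμ+ownValue<ownValue (agent _) (fwd e μi≢j))
  wμ+ownValue≤ownValue (bwd refl)   = ≤-reflexive (trans (+-identityʳ _) (⁻¹-involutive _))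

  sumFin≡sum : ∀ k (f : Fin k → ℚ) → sumFin k f ≡ sum f
  sumFin≡sum zero    f = refl
  sumFin≡sum (suc k) f = cong (f zero +_) (sumFin≡sum k (f ∘ suc))

  cycleWeight<0 : (C : Cycle) → cycleWeight C < 0ℚ
  cycleWeight<0 C = subst (_< 0ℚ) (cong (_+ wμ close) (sym (sumFin≡sum len (wμ ∘ step))))
    (closedWalk<0 len vert step close (arc-touches-agent close))
    where
    open Cycle C
    open Potential Arc wμ ownValue IsAgent wμ+ownValue≤ownValue wμ+ownValue<ownValue

lemma4 : ∀ {n m : ℕ} (v : Valuations n m) → IsMonotoneNonneg v →
           (A : Allocation n m) (C : AuxGraph.Cycle v A) →
           AuxGraph.cycleWeight v A C < 0ℚ
lemma4 v _ A C = cycleWeight<0 v A C
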